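{- Let $f$ be a distribution on $n$ binary random variables given as a set-multilinear polynomial in variables $z_1,\dots,z_n,\bar z_1,\dots,\bar z_n$ (with parts $\{z_i,\bar z_i\}$), and let $g_1,\dots,g_n$ be distributions, each on $m$ $d$-ary random variables (the variable sets of different $g_i$ being disjoint), given as set-multilinear polynomials in variables $y_{i,j,k}$, $1\le i\le n$, $1\le j\le m$, $0\le k\le d-1$ (with $g_i$ using the parts $\{y_{i,j,0},\dots,y_{i,j,d-1}\}$, $1\le j\le m$). The hierarchical composition of $f$ and $g_1,\dots,g_n$, namely the polynomial obtained from $f$ by replacing each $z_i$ by $g_i$ and each $\bar z_i$ by $\prod_{j=1}^m\sum_{k=0}^{d-1}\frac1d y_{i,j,k}$, is a probability distribution. Moreover, it can be computed by a nonmonotone probabilistic circuit whose size is linear in the sum of the sizes of the nonmonotone probabilistic circuits for $f$ and $g_1,\dots,g_n$.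
   Context: A nonmonotone probabilistic circuit is an arithmetic circuit (directed acyclic graph with input nodes labeled by variables or constants, addition nodes computing weighted sums with possibly negative weights, multiplication nodes) computing a polynomial in indicator variables whose evaluation at indicator vectors gives the probability mass function. A polynomial is set-multilinear with respect to a partition of its variables if every monomial contains exactly one variable from each part, with degree $1$; a distribution given as a set-multilinear polynomial has as coefficient of $\prod_\tau$(one variable per part) the probability of the corresponding joint outcome. -}

module Defs where

open import Data.Nat as ℕ using (ℕ; zero; suc; NonZero)
open import Data.Fin using (Fin; zero; suc)
open import Data.Integer using (+_)
open import Data.Rational using (ℚ; 0ℚ; 1ℚ; _+_; _*_; _/_; _≤_)
open import Data.Product using (Σ; _×_; _,_; ∃-syntax)
open import Data.List using (List; []; _∷_)
open import Data.Vec using (Vec; []; _∷_; lookup)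
open import Relation.Binary.PropositionalEquality using (_≡_)

sumFin : (k : ℕ) → (Fin k → ℚ) → ℚ
sumFin zero    F = 0ℚ
sumFin (suc k) F = F zero + sumFin k (λ i → F (suc i))

prodFin : (k : ℕ) → (Fin k → ℚ) → ℚ
prodFin zero    F = 1ℚ
prodFin (suc k) F = F zero * prodFin k (λ i → F (suc i))

cons : {B : Set} {k : ℕ} → B → (Fin k → B) → Fin (suc k) → B
cons b x zero    = b
cons b x (suc i) = x i

sumFun : {B : Set} (k : ℕ) → ((B → ℚ) → ℚ) → ((Fin k → B) → ℚ) → ℚ
sumFun zero    S F = F (λ ())
sumFun (suc k) S F = S (λ b → sumFun k S (λ x → F (cons b x)))

Outcome : ℕ → ℕ → Set
Outcome m d = Fin m → Fin d

-- indicator variables y_{j,k}; parts are {y_{j,0},...,y_{j,d-1}}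
Var : ℕ → ℕ → Set
Var m d = Fin m × Fin d

sumOut : (m d : ℕ) → (Outcome m d → ℚ) → ℚ
sumOut m d = sumFun m (sumFin d)

IsDist : (m d : ℕ) → (Outcome m d → ℚ) → Set
IsDist m d P = (∀ x → 0ℚ ≤ P x) × (sumOut m d P ≡ 1ℚ)

-- the set-multilinear polynomial  Σ_x P(x) ∏_j y_{j,x_j}, as a function
-- of the values of its variables (polynomials over ℚ are determined by
-- their evaluation function since ℚ is infinite)
smPoly : (m d : ℕ) → (Outcome m d → ℚ) → (Var m d → ℚ) → ℚ
smPoly m d P a = sumOut m d (λ x → P x * prodFin m (λ j → a (j , x j)))

-- a gate whose inputs are among k previously defined gates
data Gate (V : Set) (k : ℕ) : Set where
  input : V → Gate V k
  const : ℚ → Gate V k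
  wsum  : List (ℚ × Fin k) → Gate V k
  mul   : List (Fin k) → Gate V k

-- straight-line program (topologically ordered DAG) with k gates
data Circ (V : Set) : ℕ → Set where
  []  : Circ V zero
  _▷_ : {k : ℕ} → Circ V k → Gate V k → Circ V (suc k)

evalGate : {V : Set} {k : ℕ} → (V → ℚ) → Vec ℚ k → Gate V k → ℚ
evalGate a vs (input v) = a v
evalGate a vs (const c) = c
evalGate a vs (wsum ws) = go ws
  where
  go : List (ℚ × _) → ℚ
  go []             = 0ℚ
  go ((w , i) ∷ ws) = w * lookup vs i + go ws
evalGate a vs (mul is) = go is
  where
  go : List _ → ℚ
  go []       = 1ℚ
  go (i ∷ is) = lookup vs i * go is

-- values of all gates (the most recent gate first)
evalAll : {V : Set} {k : ℕ} → Circ V k → (V → ℚ) → Vec ℚ k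
evalAll []      a = []
evalAll (C ▷ g) a = let vs = evalAll C a in evalGate a vs g ∷ vs

-- a circuit: nonempty straight-line program, output = last gate
Circuit : Set → Set
Circuit V = Σ ℕ (λ k → Circ V (suc k))

eval : {V : Set} → Circuit V → (V → ℚ) → ℚ
eval (k , C ▷ g) a = evalGate a (evalAll C a) g

Computes : {V : Set} → Circuit V → ((V → ℚ) → ℚ) → Set
Computes C p = ∀ a → eval C a ≡ p a

-- number of gates plus number of wires
gateSize : {V : Set} {k : ℕ} → Gate V k → ℕ
gateSize (input _) = 1
gateSize (const _) = 1
gateSize (wsum ws) = suc (Data.List.length ws)
gateSize (mul is)  = suc (Data.List.length is)

circSize : {V : Set} {k : ℕ} → Circ V k → ℕ
circSize []      = 0
circSize (C ▷ g) = circSize C ℕ.+ gateSize g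

-- size of a probabilistic circuit over N indicator variables: the
-- circuit has one indicator leaf per variable, plus its gates and wires
pcSize : {V : Set} → ℕ → Circuit V → ℕ
pcSize N (k , C) = N ℕ.+ circSize C

uniformPoly : (m d : ℕ) → .{{NonZero d}} → (Var m d → ℚ) → ℚ
uniformPoly m d a = prodFin m (λ j → sumFin d (λ k → ((+ 1) / d) * a (j , k)))

-- f's variables are Var n 2 : (i , 1) is z_i and (i , 0) is z̄_i.
-- The composed polynomial has variables y_{i,j,k} indexed by Fin n × Var m d.
hcomp : (n m d : ℕ) → .{{NonZero d}} → (Outcome n 2 → ℚ) → (Fin n → Outcome m d → ℚ)
      → (Fin n × Var m d → ℚ) → ℚ
hcomp n m d P G a = smPoly n 2 P sub
  where
  sub : Var n 2 → ℚ
  sub (i , zero)     = uniformPoly m d (λ v → a (i , v))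
  sub (i , suc zero) = smPoly m d (G i) (λ v → a (i , v))

-- h is (the polynomial of) a probability distribution on the n·m d-ary
-- variables (i,j): it is set-multilinear w.r.t. the parts
-- {y_{i,j,0},...,y_{i,j,d-1}} with nonnegative coefficients summing to 1
IsDistPoly : (n m d : ℕ) → ((Fin n × Var m d → ℚ) → ℚ) → Set
IsDistPoly n m d h =
  ∃[ Q ] ((∀ w → 0ℚ ≤ Q w)
         × (sumFun n (sumOut m d) Q ≡ 1ℚ)
         × (∀ a → h a ≡ sumFun n (sumOut m d)
              (λ w → Q w * prodFin n (λ i → prodFin m (λ j → a (i , (j , w i j)))))))

sumFinℕ : (k : ℕ) → (Fin k → ℕ) → ℕ
sumFinℕ zero    F = 0
sumFinℕ (suc k) F = F zero ℕ.+ sumFinℕ k (λ i → F (suc i))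

-- Expanding f(…, g_i, …, u_i, …), with u_i the uniform product substituted for z̄_i, by
-- distributivity gives a set-multilinear polynomial whose coefficient at an outcome w of the
-- blocks is the probability of w in a two-stage experiment: draw x from f, then draw block i
-- from g_i if x_i = 1 and uniformly if x_i = 0. So the coefficients are nonnegative and sum
-- to 1. For the circuit, the circuit of f is grafted on top of the circuits of the g_i and of
-- circuits of size O(md) for the u_i, its inputs z_i and z̄_i reading their outputs; each u_i
-- is paid for by the md indicator leaves counted in the size of the circuit of g_i.
module Submission where

open import Defs
open import Function using (_∘_)
open import Data.Nat using (ℕ; zero; suc; NonZero)
open import Data.Fin using (Fin; zero; suc; _↑ˡ_; _↑ʳ_)
open import Data.Integer using (1ℤ)
open import Data.Rational using (ℚ)
open import Data.Product using (_×_; _,_; proj₁; proj₂; ∃-syntax)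
open import Relation.Binary.PropositionalEquality
  using (_≡_; _≗_; refl; sym; trans; cong; cong₂; module ≡-Reasoning)

module Distributions where
  open import Algebra.Bundles using (CommutativeMonoid)
  import Algebra.Properties.CommutativeSemigroup as CommutativeSemigroupProperties
  open import Data.Integer using (ℤ; +_)
  import Data.Integer as ℤ
  import Data.Integer.Properties as ℤ
  open import Data.Integer.Tactic.RingSolver using (solve-∀)
  open import Data.Rational using (0ℚ; 1ℚ; _+_; _*_; _≤_; _/_; toℚᵘ; nonNegative)
  open import Data.Rational.Properties
  import Data.Rational.Unnormalised as ℚᵘ
  import Data.Rational.Unnormalised.Properties as ℚᵘ
  open ≡-Reasoning

  open CommutativeSemigroupProperties (CommutativeMonoid.commutativeSemigroup +-0-commutativeMonoid)
    using () renaming (interchange to +-interchange)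
  open CommutativeSemigroupProperties (CommutativeMonoid.commutativeSemigroup *-1-commutativeMonoid)
    using () renaming (interchange to *-interchange)

  *-nonNeg : ∀ {p q} → 0ℚ ≤ p → 0ℚ ≤ q → 0ℚ ≤ p * q
  *-nonNeg {p} {q} 0≤p 0≤q =
    nonNegative⁻¹ (p * q) {{nonNeg*nonNeg⇒nonNeg p {{nonNegative 0≤p}} q {{nonNegative 0≤q}}}}

  record IsAdditive {B : Set} (S : (B → ℚ) → ℚ) : Set where
    field
      cong-≗ : ∀ {F G : B → ℚ} → F ≗ G → S F ≡ S G
      +-hom  : ∀ F G → S (λ b → F b + G b) ≡ S F + S G
      0-hom  : S (λ _ → 0ℚ) ≡ 0ℚ

  record IsSummation {B : Set} (S : (B → ℚ) → ℚ) : Set₁ where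
    field
      isAdditive : IsAdditive S
      *-homˡ     : ∀ c F → S (λ b → c * F b) ≡ c * S F
      nonNeg     : ∀ F → (∀ b → 0ℚ ≤ F b) → 0ℚ ≤ S F
      exchange   : ∀ {C : Set} {T : (C → ℚ) → ℚ} → IsAdditive T →
                   (F : B → C → ℚ) → S (λ b → T (F b)) ≡ T (λ c → S (λ b → F b c))

    open IsAdditive isAdditive public

    *-homʳ : ∀ c F → S (λ b → F b * c) ≡ S F * c
    *-homʳ c F = trans (cong-≗ (λ b → *-comm (F b) c)) (trans (*-homˡ c F) (*-comm c (S F)))

  sumFin-cong : ∀ k {F G : Fin k → ℚ} → F ≗ G → sumFin k F ≡ sumFin k G
  sumFin-cong zero    F≗G = refl
  sumFin-cong (suc k) F≗G = cong₂ _+_ (F≗G zero) (sumFin-cong k (F≗G ∘ suc))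

  sumFin-+ : ∀ k (F G : Fin k → ℚ) → sumFin k (λ i → F i + G i) ≡ sumFin k F + sumFin k G
  sumFin-+ zero    F G = sym (+-identityʳ 0ℚ)
  sumFin-+ (suc k) F G =
    trans (cong (_+_ (F zero + G zero)) (sumFin-+ k (F ∘ suc) (G ∘ suc)))
          (+-interchange (F zero) (G zero) (sumFin k (F ∘ suc)) (sumFin k (G ∘ suc)))

  sumFin-0 : ∀ k → sumFin k (λ _ → 0ℚ) ≡ 0ℚ
  sumFin-0 zero    = refl
  sumFin-0 (suc k) = trans (cong (_+_ 0ℚ) (sumFin-0 k)) (+-identityʳ 0ℚ)

  sumFin-*ˡ : ∀ k c (F : Fin k → ℚ) → sumFin k (λ i → c * F i) ≡ c * sumFin k F
  sumFin-*ˡ zero    c F = sym (*-zeroʳ c)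
  sumFin-*ˡ (suc k) c F =
    trans (cong (_+_ (c * F zero)) (sumFin-*ˡ k c (F ∘ suc))) (sym (*-distribˡ-+ c _ _))

  sumFin-nonNeg : ∀ k (F : Fin k → ℚ) → (∀ i → 0ℚ ≤ F i) → 0ℚ ≤ sumFin k F
  sumFin-nonNeg zero    F F≥0 = ≤-refl
  sumFin-nonNeg (suc k) F F≥0 = +-mono-≤ (F≥0 zero) (sumFin-nonNeg k (F ∘ suc) (F≥0 ∘ suc))

  sumFin-exchange : ∀ k {C : Set} {T : (C → ℚ) → ℚ} → IsAdditive T → (F : Fin k → C → ℚ) →
                    sumFin k (λ i → T (F i)) ≡ T (λ c → sumFin k (λ i → F i c))
  sumFin-exchange zero    T-add F = sym (IsAdditive.0-hom T-add)
  sumFin-exchange (suc k) {T = T} T-add F =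
    trans (cong (_+_ (T (F zero))) (sumFin-exchange k T-add (F ∘ suc)))
          (sym (IsAdditive.+-hom T-add (F zero) (λ c → sumFin k (λ i → F (suc i) c))))

  sumFin-isSummation : ∀ k → IsSummation (sumFin k)
  sumFin-isSummation k = record
    { isAdditive = record { cong-≗ = sumFin-cong k ; +-hom = sumFin-+ k ; 0-hom = sumFin-0 k }
    ; *-homˡ     = sumFin-*ˡ k
    ; nonNeg     = sumFin-nonNeg k
    ; exchange   = sumFin-exchange k
    }

  module _ {B : Set} {S : (B → ℚ) → ℚ} (S-sum : IsSummation S) where
    private module S = IsSummation S-sum

    sumFun-cong : ∀ k {F G : (Fin k → B) → ℚ} → F ≗ G → sumFun k S F ≡ sumFun k S G
    sumFun-cong zero    F≗G = F≗G _
    sumFun-cong (suc k) F≗G = S.cong-≗ (λ b → sumFun-cong k (λ x → F≗G (cons b x)))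

    sumFun-+ : ∀ k F G → sumFun k S (λ x → F x + G x) ≡ sumFun k S F + sumFun k S G
    sumFun-+ zero    F G = refl
    sumFun-+ (suc k) F G = trans (S.cong-≗ (λ b → sumFun-+ k _ _)) (S.+-hom _ _)

    sumFun-0 : ∀ k → sumFun k S (λ _ → 0ℚ) ≡ 0ℚ
    sumFun-0 zero    = refl
    sumFun-0 (suc k) = trans (S.cong-≗ (λ b → sumFun-0 k)) S.0-hom

    sumFun-*ˡ : ∀ k c F → sumFun k S (λ x → c * F x) ≡ c * sumFun k S F
    sumFun-*ˡ zero    c F = refl
    sumFun-*ˡ (suc k) c F = trans (S.cong-≗ (λ b → sumFun-*ˡ k c _)) (S.*-homˡ c _)

    sumFun-nonNeg : ∀ k F → (∀ x → 0ℚ ≤ F x) → 0ℚ ≤ sumFun k S F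
    sumFun-nonNeg zero    F F≥0 = F≥0 _
    sumFun-nonNeg (suc k) F F≥0 = S.nonNeg _ (λ b → sumFun-nonNeg k _ (λ x → F≥0 (cons b x)))

    sumFun-exchange : ∀ k {C : Set} {T : (C → ℚ) → ℚ} → IsAdditive T →
                      (F : (Fin k → B) → C → ℚ) →
                      sumFun k S (λ x → T (F x)) ≡ T (λ c → sumFun k S (λ x → F x c))
    sumFun-exchange zero    T-add F = refl
    sumFun-exchange (suc k) T-add F =
      trans (S.cong-≗ (λ b → sumFun-exchange k T-add _)) (S.exchange T-add _)

    sumFun-isSummation : ∀ k → IsSummation (sumFun k S)
    sumFun-isSummation k = record
      { isAdditive = record { cong-≗ = sumFun-cong k ; +-hom = sumFun-+ k ; 0-hom = sumFun-0 k }
      ; *-homˡ     = sumFun-*ˡ k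
      ; nonNeg     = sumFun-nonNeg k
      ; exchange   = sumFun-exchange k
      }

  sumOut-isSummation : ∀ m d → IsSummation (sumOut m d)
  sumOut-isSummation m d = sumFun-isSummation (sumFin-isSummation d) m

  prodFin-cong : ∀ k {F G : Fin k → ℚ} → F ≗ G → prodFin k F ≡ prodFin k G
  prodFin-cong zero    F≗G = refl
  prodFin-cong (suc k) F≗G = cong₂ _*_ (F≗G zero) (prodFin-cong k (F≗G ∘ suc))

  prodFin-* : ∀ k (F G : Fin k → ℚ) → prodFin k (λ i → F i * G i) ≡ prodFin k F * prodFin k G
  prodFin-* zero    F G = sym (*-identityʳ 1ℚ)
  prodFin-* (suc k) F G =
    trans (cong (_*_ (F zero * G zero)) (prodFin-* k (F ∘ suc) (G ∘ suc)))
          (*-interchange (F zero) (G zero) (prodFin k (F ∘ suc)) (prodFin k (G ∘ suc)))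

  prodFin-1 : ∀ k → prodFin k (λ _ → 1ℚ) ≡ 1ℚ
  prodFin-1 zero    = refl
  prodFin-1 (suc k) = trans (cong (1ℚ *_) (prodFin-1 k)) (*-identityʳ 1ℚ)

  prodFin-nonNeg : ∀ k (F : Fin k → ℚ) → (∀ i → 0ℚ ≤ F i) → 0ℚ ≤ prodFin k F
  prodFin-nonNeg zero    F F≥0 = nonNegative⁻¹ 1ℚ
  prodFin-nonNeg (suc k) F F≥0 = *-nonNeg (F≥0 zero) (prodFin-nonNeg k (F ∘ suc) (F≥0 ∘ suc))

  prodFin-sumFun : ∀ {B : Set} {S : (B → ℚ) → ℚ} → IsSummation S → ∀ k (F : Fin k → B → ℚ) →
                   prodFin k (λ i → S (F i)) ≡ sumFun k S (λ x → prodFin k (λ i → F i (x i)))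
  prodFin-sumFun S-sum zero    F = refl
  prodFin-sumFun {S = S} S-sum (suc k) F = begin
    S (F zero) * prodFin k (λ i → S (F (suc i)))
      ≡⟨ cong (S (F zero) *_) (prodFin-sumFun S-sum k (F ∘ suc)) ⟩
    S (F zero) * rest
      ≡⟨ sym (IsSummation.*-homʳ S-sum rest (F zero)) ⟩
    S (λ b → F zero b * rest)
      ≡⟨ IsSummation.cong-≗ S-sum (λ b → sym (sumFun-*ˡ S-sum k (F zero b) _)) ⟩
    sumFun (suc k) S (λ x → prodFin (suc k) (λ i → F i (x i)))  ∎
    where
    rest : ℚ
    rest = sumFun k S (λ x → prodFin k (λ i → F (suc i) (x i)))

  -- Computed in ℚᵘ, where the partial sums k / d need no normalisation.
  sumFin-1/ : ∀ d .{{_ : NonZero d}} → sumFin d (λ _ → 1ℤ / d) ≡ 1ℚ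
  sumFin-1/ (suc d) =
    toℚᵘ-injective (ℚᵘ.≃-trans (partialSum (suc d)) (ℚᵘ.*≡* (ℤ.*-comm (+ suc d) (+ 1))))
    where
    fraction-+ : ∀ (D K : ℤ) → (1ℤ ℤ.* D ℤ.+ K ℤ.* D) ℤ.* D ≡ (1ℤ ℤ.+ K) ℤ.* (D ℤ.* D)
    fraction-+ = solve-∀

    partialSum : ∀ k → toℚᵘ (sumFin k (λ _ → 1ℤ / suc d)) ℚᵘ.≃ ℚᵘ.mkℚᵘ (+ k) d
    partialSum zero    = ℚᵘ.*≡* refl
    partialSum (suc k) =
      ℚᵘ.≃-trans (toℚᵘ-homo-+ (1ℤ / suc d) (sumFin k (λ _ → 1ℤ / suc d)))
        (ℚᵘ.≃-trans (ℚᵘ.+-cong (toℚᵘ-fromℚᵘ (ℚᵘ.mkℚᵘ 1ℤ d)) (partialSum k))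
          (ℚᵘ.*≡* (fraction-+ (+ suc d) (+ k))))

  1/-nonNeg : ∀ d .{{_ : NonZero d}} → 0ℚ ≤ 1ℤ / d
  1/-nonNeg d = nonNegative⁻¹ _ {{normalize-nonNeg 1 d}}

  smPoly-cong : ∀ m d (P : Outcome m d → ℚ) {a a′ : Var m d → ℚ} → a ≗ a′ →
                smPoly m d P a ≡ smPoly m d P a′
  smPoly-cong m d P a≗a′ = sumFun-cong (sumFin-isSummation d) m
    (λ x → cong (P x *_) (prodFin-cong m (λ j → a≗a′ (j , x j))))

  IsDistPoly-≗ : ∀ {n m d} {h h′ : (Fin n × Var m d → ℚ) → ℚ} → h ≗ h′ →
                 IsDistPoly n m d h → IsDistPoly n m d h′
  IsDistPoly-≗ h≗h′ (Q , Q≥0 , ΣQ≡1 , h≡) = Q , Q≥0 , ΣQ≡1 , (λ a → trans (sym (h≗h′ a)) (h≡ a))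

  monomial : (n m d : ℕ) → (Fin n × Var m d → ℚ) → (Fin n → Outcome m d) → ℚ
  monomial n m d a w = prodFin n (λ i → prodFin m (λ j → a (i , (j , w i j))))

  substitute : (n e m d : ℕ) → (Outcome n e → ℚ) → (Fin n → Fin e → Outcome m d → ℚ) →
               (Fin n × Var m d → ℚ) → ℚ
  substitute n e m d P H a = smPoly n e P (λ (i , b) → smPoly m d (H i b) (λ v → a (i , v)))

  -- The law of w when x is drawn from P and then each w i independently from H i (x i).
  mixture : (n e m d : ℕ) → (Outcome n e → ℚ) → (Fin n → Fin e → Outcome m d → ℚ) →
            (Fin n → Outcome m d) → ℚ
  mixture n e m d P H w = sumOut n e (λ x → P x * prodFin n (λ i → H i (x i) (w i)))

  module _ (n e m d : ℕ) (P : Outcome n e → ℚ) (H : Fin n → Fin e → Outcome m d → ℚ) where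
    private
      module X = IsSummation (sumOut-isSummation n e)
      module W = IsSummation (sumFun-isSummation (sumOut-isSummation m d) n)

      ΣX : (Outcome n e → ℚ) → ℚ
      ΣX = sumOut n e

      ΣW : ((Fin n → Outcome m d) → ℚ) → ℚ
      ΣW = sumFun n (sumOut m d)

      weight : Outcome n e → (Fin n → Outcome m d) → ℚ
      weight x w = prodFin n (λ i → H i (x i) (w i))

    substitute-expand : ∀ a → substitute n e m d P H a
                            ≡ sumFun n (sumOut m d) (λ w → mixture n e m d P H w * monomial n m d a w)
    substitute-expand a = begin
      ΣX (λ x → P x * prodFin n (λ i → sumOut m d (λ y → H i (x i) y * block i y)))
        ≡⟨ X.cong-≗ (λ x → cong (P x *_) (prodFin-sumFun (sumOut-isSummation m d) n _)) ⟩
      ΣX (λ x → P x * ΣW (λ w → prodFin n (λ i → H i (x i) (w i) * block i (w i))))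
        ≡⟨ X.cong-≗ (λ x → cong (P x *_) (W.cong-≗ (λ w → prodFin-* n _ _))) ⟩
      ΣX (λ x → P x * ΣW (λ w → weight x w * M w))
        ≡⟨ X.cong-≗ (λ x → sym (W.*-homˡ (P x) _)) ⟩
      ΣX (λ x → ΣW (λ w → P x * (weight x w * M w)))
        ≡⟨ X.exchange W.isAdditive _ ⟩
      ΣW (λ w → ΣX (λ x → P x * (weight x w * M w)))
        ≡⟨ W.cong-≗ (λ w → trans (X.cong-≗ (λ x → sym (*-assoc (P x) _ _))) (X.*-homʳ _ _)) ⟩
      ΣW (λ w → mixture n e m d P H w * M w)  ∎
      where
      block : Fin n → Outcome m d → ℚ
      block i y = prodFin m (λ j → a (i , (j , y j)))

      M : (Fin n → Outcome m d) → ℚ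
      M = monomial n m d a

    mixture-nonNeg : IsDist n e P → (∀ i b y → 0ℚ ≤ H i b y) → ∀ w → 0ℚ ≤ mixture n e m d P H w
    mixture-nonNeg (P≥0 , _) H≥0 w =
      X.nonNeg _ (λ x → *-nonNeg (P≥0 x) (prodFin-nonNeg n _ (λ i → H≥0 i (x i) (w i))))

    mixture-sum : IsDist n e P → (∀ i b → sumOut m d (H i b) ≡ 1ℚ) →
                  sumFun n (sumOut m d) (mixture n e m d P H) ≡ 1ℚ
    mixture-sum (_ , ΣP≡1) ΣH≡1 = begin
      ΣW (λ w → ΣX (λ x → P x * weight x w))  ≡⟨ W.exchange X.isAdditive _ ⟩
      ΣX (λ x → ΣW (λ w → P x * weight x w))  ≡⟨ X.cong-≗ (λ x → W.*-homˡ (P x) _) ⟩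
      ΣX (λ x → P x * ΣW (weight x))
        ≡⟨ X.cong-≗ (λ x → cong (P x *_) (sym (prodFin-sumFun (sumOut-isSummation m d) n _))) ⟩
      ΣX (λ x → P x * prodFin n (λ i → sumOut m d (H i (x i))))
        ≡⟨ X.cong-≗ (λ x → cong (P x *_) (trans (prodFin-cong n (λ i → ΣH≡1 i (x i))) (prodFin-1 n))) ⟩
      ΣX (λ x → P x * 1ℚ)  ≡⟨ X.cong-≗ (λ x → *-identityʳ (P x)) ⟩
      ΣX P                 ≡⟨ ΣP≡1 ⟩
      1ℚ                   ∎

    substitute-isDistPoly : IsDist n e P → (∀ i b → IsDist m d (H i b)) →
                            IsDistPoly n m d (substitute n e m d P H)
    substitute-isDistPoly isDistP isDistH =
      mixture n e m d P H ,
      mixture-nonNeg isDistP (λ i b → proj₁ (isDistH i b)) ,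
      mixture-sum isDistP (λ i b → proj₂ (isDistH i b)) ,
      substitute-expand

  uniform : (m d : ℕ) → .{{NonZero d}} → Outcome m d → ℚ
  uniform m d _ = prodFin m (λ _ → 1ℤ / d)

  uniform-isDist : ∀ m d .{{_ : NonZero d}} → IsDist m d (uniform m d)
  uniform-isDist m d = (λ _ → prodFin-nonNeg m _ (λ _ → 1/-nonNeg d)) , (begin
    sumOut m d (uniform m d)                 ≡⟨ sym (prodFin-sumFun (sumFin-isSummation d) m _) ⟩
    prodFin m (λ _ → sumFin d (λ _ → 1ℤ / d)) ≡⟨ prodFin-cong m (λ _ → sumFin-1/ d) ⟩
    prodFin m (λ _ → 1ℚ)                     ≡⟨ prodFin-1 m ⟩
    1ℚ                                       ∎)

  uniformPoly-smPoly : ∀ m d .{{_ : NonZero d}} a → uniformPoly m d a ≡ smPoly m d (uniform m d) a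
  uniformPoly-smPoly m d a =
    trans (prodFin-sumFun (sumFin-isSummation d) m _)
          (sumFun-cong (sumFin-isSummation d) m (λ y → prodFin-* m _ _))

  hcompSubstituent : (m d : ℕ) → .{{NonZero d}} → (Outcome m d → ℚ) → Fin 2 → Outcome m d → ℚ
  hcompSubstituent m d g = cons (uniform m d) (λ _ → g)

  -- Lets a caller's substitution stay unnamed (hcomp's is a where-bound function): K is inferred
  -- from the unfolded polynomial and must depend on x only through x i.
  smPoly-cong-unfolded : ∀ n e (P : Outcome n e → ℚ) {K : (Fin n → Fin e) → Fin n → ℚ}
                         (a : Var n e → ℚ) → (∀ x i → K x i ≡ K (λ _ → x i) i) →
                         (∀ i b → K (λ _ → b) i ≡ a (i , b)) →
                         sumOut n e (λ x → P x * prodFin n (K x)) ≡ smPoly n e P a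
  smPoly-cong-unfolded n e P a K-local K≡a = sumFun-cong (sumFin-isSummation e) n
    (λ x → cong (P x *_) (prodFin-cong n (λ i → trans (K-local x i) (K≡a i (x i)))))

  hcomp-substitute : ∀ n m d .{{_ : NonZero d}} P G a →
                     hcomp n m d P G a ≡ substitute n 2 m d P (λ i → hcompSubstituent m d (G i)) a
  hcomp-substitute n m d P G a =
    smPoly-cong-unfolded n 2 P (λ (i , b) → smPoly m d (hcompSubstituent m d (G i) b) (λ v → a (i , v)))
      (λ x i → refl) λ where
        i zero       → uniformPoly-smPoly m d (λ v → a (i , v))
        i (suc zero) → refl

  hcomp-isDistPoly : ∀ n m d .{{_ : NonZero d}} (P : Outcome n 2 → ℚ) (G : Fin n → Outcome m d → ℚ) →
                     IsDist n 2 P → (∀ i → IsDist m d (G i)) →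
                     IsDistPoly n m d (hcomp n m d P G)
  hcomp-isDistPoly n m d P G isDistP isDistG =
    IsDistPoly-≗ (λ a → sym (hcomp-substitute n m d P G a))
      (substitute-isDistPoly n 2 m d P (λ i → hcompSubstituent m d (G i)) isDistP isDistSubst)
    where
    isDistSubst : ∀ i b → IsDist m d (hcompSubstituent m d (G i) b)
    isDistSubst i zero       = uniform-isDist m d
    isDistSubst i (suc zero) = isDistG i

open Distributions

open import Data.Nat using (_+_; _*_; _≤_; _<_; z≤n; s≤s)
open import Data.Nat.Properties
  using (≤-trans; ≤-reflexive; +-mono-≤; +-monoˡ-≤; +-monoʳ-≤; m≤m+n; m≤n+m; +-assoc; +-identityʳ;
         *-identityʳ; *-zeroʳ; *-distribˡ-+; module ≤-Reasoning)
open import Data.Nat.Tactic.RingSolver using (solve-∀)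
import Data.Rational as ℚ
import Data.Rational.Properties as ℚ
open import Data.Sum using (_⊎_; inj₁; inj₂; [_,_]′)
open import Data.Unit using (⊤; tt)
open import Data.List using ([]; _∷_; map; tabulate)
open import Data.List.Properties using (length-map; length-tabulate)
open import Data.Vec using (Vec; _∷_; lookup; _++_)
open import Data.Vec.Properties using (lookup-++ˡ; lookup-++ʳ)

sumFinℕ-cong : ∀ t {F G : Fin t → ℕ} → F ≗ G → sumFinℕ t F ≡ sumFinℕ t G
sumFinℕ-cong zero    F≗G = refl
sumFinℕ-cong (suc t) F≗G = cong₂ _+_ (F≗G zero) (sumFinℕ-cong t (F≗G ∘ suc))

sumFinℕ-mono-≤ : ∀ t {F G : Fin t → ℕ} → (∀ s → F s ≤ G s) → sumFinℕ t F ≤ sumFinℕ t G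
sumFinℕ-mono-≤ zero    F≤G = z≤n
sumFinℕ-mono-≤ (suc t) F≤G = +-mono-≤ (F≤G zero) (sumFinℕ-mono-≤ t (F≤G ∘ suc))

sumFinℕ-const : ∀ t c → sumFinℕ t (λ _ → c) ≡ t * c
sumFinℕ-const zero    c = refl
sumFinℕ-const (suc t) c = cong (c +_) (sumFinℕ-const t c)

sumFinℕ-*ˡ : ∀ t c (F : Fin t → ℕ) → sumFinℕ t (λ s → c * F s) ≡ c * sumFinℕ t F
sumFinℕ-*ˡ zero    c F = sym (*-zeroʳ c)
sumFinℕ-*ˡ (suc t) c F =
  trans (cong (c * F zero +_) (sumFinℕ-*ˡ t c (F ∘ suc))) (sym (*-distribˡ-+ c (F zero) _))

circuitSize : {V : Set} → Circuit V → ℕ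
circuitSize (_ , C) = circSize C

gateSize-positive : ∀ {V k} (g : Gate V k) → 0 < gateSize g
gateSize-positive (input _) = s≤s z≤n
gateSize-positive (const _) = s≤s z≤n
gateSize-positive (wsum _)  = s≤s z≤n
gateSize-positive (mul _)   = s≤s z≤n

circuitSize-positive : ∀ {V} (C : Circuit V) → 0 < circuitSize C
circuitSize-positive (_ , C ▷ g) = ≤-trans (gateSize-positive g) (m≤n+m _ (circSize C))

read : {W : Set} {p : ℕ} → (W → ℚ) → Vec ℚ p → W ⊎ Fin p → ℚ
read a us = [ a , lookup us ]′

-- A wire cannot lead to an input directly, so reading gate q takes the one-factor product of q.
readGate : {W : Set} {p : ℕ} (j : ℕ) → W ⊎ Fin p → Gate W (j + p)
readGate j (inj₁ w) = input w
readGate j (inj₂ q) = mul ((j ↑ʳ q) ∷ [])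

graftGate : {V W : Set} {p j : ℕ} → (V → W ⊎ Fin p) → Gate V j → Gate W (j + p)
graftGate {j = j} σ (input v) = readGate j (σ v)
graftGate         σ (const c) = const c
graftGate {p = p} σ (wsum ws) = wsum (map (λ (w , i) → w , i ↑ˡ p) ws)
graftGate {p = p} σ (mul is)  = mul (map (_↑ˡ p) is)

-- C runs on top of pre, reading its variable v from the input or the gate of pre named by σ v.
graft : {V W : Set} {p k : ℕ} → Circ W p → (V → W ⊎ Fin p) → Circ V k → Circ W (k + p)
graft pre σ []      = pre
graft pre σ (C ▷ g) = graft pre σ C ▷ graftGate σ g

module _ {W : Set} {p : ℕ} (a : W → ℚ) (us : Vec ℚ p) where

  evalGate-readGate : ∀ {j} (vs : Vec ℚ j) z → evalGate a (vs ++ us) (readGate j z) ≡ read a us z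
  evalGate-readGate vs (inj₁ w) = refl
  evalGate-readGate vs (inj₂ q) = trans (ℚ.*-identityʳ _) (lookup-++ʳ vs us q)

  evalGate-graftGate : ∀ {V j} (σ : V → W ⊎ Fin p) (vs : Vec ℚ j) (g : Gate V j) →
                       evalGate a (vs ++ us) (graftGate σ g) ≡ evalGate (read a us ∘ σ) vs g
  evalGate-graftGate σ vs (input v)            = evalGate-readGate vs (σ v)
  evalGate-graftGate σ vs (const c)            = refl
  evalGate-graftGate σ vs (wsum [])            = refl
  evalGate-graftGate σ vs (wsum ((w , i) ∷ ws)) =
    cong₂ ℚ._+_ (cong (w ℚ.*_) (lookup-++ˡ vs us i)) (evalGate-graftGate σ vs (wsum ws))
  evalGate-graftGate σ vs (mul [])             = refl
  evalGate-graftGate σ vs (mul (i ∷ is))       =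
    cong₂ ℚ._*_ (lookup-++ˡ vs us i) (evalGate-graftGate σ vs (mul is))

evalAll-graft : ∀ {V W p k} (pre : Circ W p) (σ : V → W ⊎ Fin p) (C : Circ V k) a →
                evalAll (graft pre σ C) a ≡ evalAll C (read a (evalAll pre a) ∘ σ) ++ evalAll pre a
evalAll-graft pre σ []      a = refl
evalAll-graft pre σ (C ▷ g) a =
  trans (cong (λ vs → evalGate a vs (graftGate σ g) ∷ vs) (evalAll-graft pre σ C a))
        (cong (_∷ _) (evalGate-graftGate a (evalAll pre a) σ (evalAll C _) g))

gateSize-readGate : ∀ {W p} j (z : W ⊎ Fin p) → gateSize (readGate j z) ≤ 2
gateSize-readGate j (inj₁ _) = s≤s z≤n
gateSize-readGate j (inj₂ _) = s≤s (s≤s z≤n)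

gateSize-graftGate : ∀ {V W p j} (σ : V → W ⊎ Fin p) (g : Gate V j) →
                     gateSize (graftGate σ g) ≤ 2 * gateSize g
gateSize-graftGate {j = j} σ (input v) = gateSize-readGate j (σ v)
gateSize-graftGate σ (const c) = s≤s z≤n
gateSize-graftGate σ (wsum ws) = ≤-trans (≤-reflexive (cong suc (length-map _ ws))) (m≤m+n _ _)
gateSize-graftGate σ (mul is)  = ≤-trans (≤-reflexive (cong suc (length-map _ is))) (m≤m+n _ _)

gateSize-graftGate-inputs : ∀ {V W p j} (f : V → W) (g : Gate V j) →
                            gateSize (graftGate {p = p} (inj₁ ∘ f) g) ≡ gateSize g
gateSize-graftGate-inputs f (input v) = refl
gateSize-graftGate-inputs f (const c) = refl
gateSize-graftGate-inputs f (wsum ws) = cong suc (length-map _ ws)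
gateSize-graftGate-inputs f (mul is)  = cong suc (length-map _ is)

circSize-graft : ∀ {V W p k} (pre : Circ W p) (σ : V → W ⊎ Fin p) (C : Circ V k) →
                 circSize (graft pre σ C) ≤ circSize pre + 2 * circSize C
circSize-graft pre σ []      = m≤m+n _ _
circSize-graft pre σ (C ▷ g) = ≤-trans (+-mono-≤ (circSize-graft pre σ C) (gateSize-graftGate σ g))
  (≤-reflexive (trans (+-assoc (circSize pre) _ _)
                      (cong (circSize pre +_) (sym (*-distribˡ-+ 2 (circSize C) (gateSize g))))))

circSize-graft-inputs : ∀ {V W p k} (pre : Circ W p) (f : V → W) (C : Circ V k) →
                        circSize (graft pre (inj₁ ∘ f) C) ≡ circSize pre + circSize C
circSize-graft-inputs pre f []      = sym (+-identityʳ _)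
circSize-graft-inputs pre f (C ▷ g) =
  trans (cong₂ _+_ (circSize-graft-inputs pre f C) (gateSize-graftGate-inputs f g))
        (+-assoc (circSize pre) (circSize C) (gateSize g))

graftCircuit : {V W : Set} {p : ℕ} → Circ W p → (V → W ⊎ Fin p) → Circuit V → Circuit W
graftCircuit {p = p} pre σ (k , C) = k + p , graft pre σ C

eval-graftCircuit : ∀ {V W p} (pre : Circ W p) (σ : V → W ⊎ Fin p) (C : Circuit V) a →
                    eval (graftCircuit pre σ C) a ≡ eval C (read a (evalAll pre a) ∘ σ)
eval-graftCircuit pre σ (k , C ▷ g) a =
  trans (cong (λ vs → evalGate a vs (graftGate σ g)) (evalAll-graft pre σ C a))
        (evalGate-graftGate a (evalAll pre a) σ (evalAll C _) g)

rename : {V W : Set} → (V → W) → Circuit V → Circuit W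
rename f = graftCircuit [] (inj₁ ∘ f)

eval-rename : ∀ {V W} (f : V → W) (C : Circuit V) a → eval (rename f C) a ≡ eval C (a ∘ f)
eval-rename f = eval-graftCircuit [] (inj₁ ∘ f)

circuitSize-rename : ∀ {V W} (f : V → W) (C : Circuit V) → circuitSize (rename f C) ≡ circuitSize C
circuitSize-rename f (k , C) = circSize-graft-inputs [] f C

record Tabulation (W I : Set) : Set where
  constructor tabulation
  field
    width   : ℕ
    program : Circ W width
    gate    : I → Fin width

  value : (W → ℚ) → I → ℚ
  value a i = lookup (evalAll program a) (gate i)

  size : ℕ
  size = circSize program

open Tabulation

output : {W : Set} → Circuit W → Tabulation W ⊤
output (k , C) = tabulation (suc k) C (λ _ → zero)

value-output : ∀ {W} (C : Circuit W) a → value (output C) a tt ≡ eval C a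
value-output (k , C ▷ g) a = refl

reindex : {W I J : Set} → (J → I) → Tabulation W I → Tabulation W J
reindex f T = tabulation (width T) (program T) (gate T ∘ f)

_⊕_ : {W I J : Set} → Tabulation W I → Tabulation W J → Tabulation W (I ⊎ J)
T ⊕ U = tabulation (width U + width T) (graft (program T) inj₁ (program U))
                   [ (width U ↑ʳ_) ∘ gate T , (_↑ˡ width T) ∘ gate U ]′

module _ {W I J : Set} (T : Tabulation W I) (U : Tabulation W J) (a : W → ℚ) where

  evalAll-⊕ : evalAll (program (T ⊕ U)) a ≡ evalAll (program U) a ++ evalAll (program T) a
  evalAll-⊕ = evalAll-graft (program T) inj₁ (program U) a

  value-⊕ˡ : ∀ i → value (T ⊕ U) a (inj₁ i) ≡ value T a i
  value-⊕ˡ i = trans (cong (λ vs → lookup vs (width U ↑ʳ gate T i)) evalAll-⊕)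
                     (lookup-++ʳ (evalAll (program U) a) (evalAll (program T) a) (gate T i))

  value-⊕ʳ : ∀ j → value (T ⊕ U) a (inj₂ j) ≡ value U a j
  value-⊕ʳ j = trans (cong (λ vs → lookup vs (gate U j ↑ˡ width T)) evalAll-⊕)
                     (lookup-++ˡ (evalAll (program U) a) (evalAll (program T) a) (gate U j))

size-⊕ : ∀ {W I J} (T : Tabulation W I) (U : Tabulation W J) → size (T ⊕ U) ≡ size T + size U
size-⊕ T U = circSize-graft-inputs (program T) (λ w → w) (program U)

⨁ : {W I : Set} (t : ℕ) → (Fin t → Tabulation W I) → Tabulation W (Fin t × I)
⨁ zero    T = tabulation 0 [] λ { (() , _) }
⨁ {I = I} (suc t) T = reindex uncons (T zero ⊕ ⨁ t (T ∘ suc))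
  where
  uncons : Fin (suc t) × I → I ⊎ (Fin t × I)
  uncons (zero  , x) = inj₁ x
  uncons (suc s , x) = inj₂ (s , x)

value-⨁ : ∀ {W I} t (T : Fin t → Tabulation W I) a s x →
          value (⨁ t T) a (s , x) ≡ value (T s) a x
value-⨁ (suc t) T a zero    x = value-⊕ˡ (T zero) (⨁ t (T ∘ suc)) a x
value-⨁ (suc t) T a (suc s) x =
  trans (value-⊕ʳ (T zero) (⨁ t (T ∘ suc)) a (s , x)) (value-⨁ t (T ∘ suc) a s x)

size-⨁ : ∀ {W I} t (T : Fin t → Tabulation W I) → size (⨁ t T) ≡ sumFinℕ t (λ s → size (T s))
size-⨁ zero    T = refl
size-⨁ (suc t) T =
  trans (size-⊕ (T zero) (⨁ t (T ∘ suc))) (cong (size (T zero) +_) (size-⨁ t (T ∘ suc)))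

circuits : {W : Set} (t : ℕ) → (Fin t → Circuit W) → Tabulation W (Fin t)
circuits t C = reindex (_, tt) (⨁ t (output ∘ C))

value-circuits : ∀ {W} t (C : Fin t → Circuit W) a s → value (circuits t C) a s ≡ eval (C s) a
value-circuits t C a s = trans (value-⨁ t (output ∘ C) a s tt) (value-output (C s) a)

size-circuits : ∀ {W} t (C : Fin t → Circuit W) → size (circuits t C) ≡ sumFinℕ t (circuitSize ∘ C)
size-circuits t C = size-⨁ t (output ∘ C)

compose : {V W : Set} → Tabulation W V → Circuit V → Circuit W
compose T = graftCircuit (program T) (inj₂ ∘ gate T)

eval-compose : ∀ {V W} (T : Tabulation W V) (C : Circuit V) a →
               eval (compose T C) a ≡ eval C (value T a)
eval-compose T = eval-graftCircuit (program T) (inj₂ ∘ gate T)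

circuitSize-compose : ∀ {V W} (T : Tabulation W V) (C : Circuit V) →
                      circuitSize (compose T C) ≤ size T + 2 * circuitSize C
circuitSize-compose T (k , C) = circSize-graft (program T) (inj₂ ∘ gate T) C

linearCircuit : {W : Set} {t : ℕ} → Tabulation W (Fin t) → (Fin t → ℚ) → Circuit W
linearCircuit T c = width T , program T ▷ wsum (tabulate (λ s → c s , gate T s))

productCircuit : {W : Set} {t : ℕ} → Tabulation W (Fin t) → Circuit W
productCircuit T = width T , program T ▷ mul (tabulate (gate T))

module _ {W : Set} {k : ℕ} (a : W → ℚ) (vs : Vec ℚ k) where

  evalGate-wsum-tabulate : ∀ t (c : Fin t → ℚ) (ix : Fin t → Fin k) →
    evalGate a vs (wsum (tabulate (λ s → c s , ix s))) ≡ sumFin t (λ s → c s ℚ.* lookup vs (ix s))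
  evalGate-wsum-tabulate zero    c ix = refl
  evalGate-wsum-tabulate (suc t) c ix =
    cong (ℚ._+_ (c zero ℚ.* lookup vs (ix zero))) (evalGate-wsum-tabulate t (c ∘ suc) (ix ∘ suc))

  evalGate-mul-tabulate : ∀ t (ix : Fin t → Fin k) →
    evalGate a vs (mul (tabulate ix)) ≡ prodFin t (λ s → lookup vs (ix s))
  evalGate-mul-tabulate zero    ix = refl
  evalGate-mul-tabulate (suc t) ix =
    cong (ℚ._*_ (lookup vs (ix zero))) (evalGate-mul-tabulate t (ix ∘ suc))

eval-linearCircuit : ∀ {W t} (T : Tabulation W (Fin t)) c a →
                     eval (linearCircuit T c) a ≡ sumFin t (λ s → c s ℚ.* value T a s)
eval-linearCircuit {t = t} T c a = evalGate-wsum-tabulate a (evalAll (program T) a) t c (gate T)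

eval-productCircuit : ∀ {W t} (T : Tabulation W (Fin t)) a →
                      eval (productCircuit T) a ≡ prodFin t (value T a)
eval-productCircuit {t = t} T a = evalGate-mul-tabulate a (evalAll (program T) a) t (gate T)

circuitSize-linearCircuit : ∀ {W t} (T : Tabulation W (Fin t)) c →
                            circuitSize (linearCircuit T c) ≡ size T + suc t
circuitSize-linearCircuit T c = cong (λ l → size T + suc l) (length-tabulate _)

circuitSize-productCircuit : ∀ {W t} (T : Tabulation W (Fin t)) →
                             circuitSize (productCircuit T) ≡ size T + suc t
circuitSize-productCircuit T = cong (λ l → size T + suc l) (length-tabulate _)

inputCircuit : {W : Set} → W → Circuit W
inputCircuit w = 0 , [] ▷ input w

uniformSum : (m d : ℕ) → .{{NonZero d}} → Fin m → Circuit (Var m d)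
uniformSum m d j = linearCircuit (circuits d (inputCircuit ∘ (j ,_))) (λ _ → 1ℤ ℚ./ d)

uniformCircuit : (m d : ℕ) → .{{NonZero d}} → Circuit (Var m d)
uniformCircuit m d = productCircuit (circuits m (uniformSum m d))

eval-uniformCircuit : ∀ m d .{{_ : NonZero d}} a → eval (uniformCircuit m d) a ≡ uniformPoly m d a
eval-uniformCircuit m d a =
  trans (eval-productCircuit (circuits m (uniformSum m d)) a) (prodFin-cong m (λ j → begin
    value (circuits m (uniformSum m d)) a j
      ≡⟨ value-circuits m (uniformSum m d) a j ⟩
    eval (uniformSum m d j) a
      ≡⟨ eval-linearCircuit (inputs j) (λ _ → 1ℤ ℚ./ d) a ⟩
    sumFin d (λ k → 1ℤ ℚ./ d ℚ.* value (inputs j) a k)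
      ≡⟨ sumFin-cong d (λ k → cong (1ℤ ℚ./ d ℚ.*_) (value-circuits d (inputCircuit ∘ (j ,_)) a k)) ⟩
    sumFin d (λ k → 1ℤ ℚ./ d ℚ.* a (j , k))              ∎))
  where
  open ≡-Reasoning
  inputs : Fin m → Tabulation (Var m d) (Fin d)
  inputs j = circuits d (inputCircuit ∘ (j ,_))

circuitSize-uniformSum : ∀ m d .{{_ : NonZero d}} j → circuitSize (uniformSum m d j) ≡ d + suc d
circuitSize-uniformSum m d j = begin
  circuitSize (uniformSum m d j)   ≡⟨ circuitSize-linearCircuit inputs (λ _ → 1ℤ ℚ./ d) ⟩
  size inputs + suc d              ≡⟨ cong (_+ suc d) (size-circuits d (inputCircuit ∘ (j ,_))) ⟩
  sumFinℕ d (λ _ → 1) + suc d      ≡⟨ cong (_+ suc d) (trans (sumFinℕ-const d 1) (*-identityʳ d)) ⟩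
  d + suc d                        ∎
  where
  open ≡-Reasoning
  inputs : Tabulation (Var m d) (Fin d)
  inputs = circuits d (inputCircuit ∘ (j ,_))

circuitSize-uniformCircuit : ∀ m d .{{_ : NonZero d}} →
                             circuitSize (uniformCircuit m d) ≡ m * (d + suc d) + suc m
circuitSize-uniformCircuit m d = begin
  circuitSize (uniformCircuit m d)
    ≡⟨ circuitSize-productCircuit (circuits m (uniformSum m d)) ⟩
  size (circuits m (uniformSum m d)) + suc m
    ≡⟨ cong (_+ suc m) (size-circuits m (uniformSum m d)) ⟩
  sumFinℕ m (circuitSize ∘ uniformSum m d) + suc m
    ≡⟨ cong (_+ suc m) (sumFinℕ-cong m (circuitSize-uniformSum m d)) ⟩
  sumFinℕ m (λ _ → d + suc d) + suc m
    ≡⟨ cong (_+ suc m) (sumFinℕ-const m (d + suc d)) ⟩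
  m * (d + suc d) + suc m  ∎
  where open ≡-Reasoning

module _ {n e m d : ℕ} where

  substituteCircuit : Circuit (Var n e) → (Fin n → Fin e → Circuit (Var m d)) →
                      Circuit (Fin n × Var m d)
  substituteCircuit Cf Ch = compose (⨁ n (λ i → circuits e (rename (i ,_) ∘ Ch i))) Cf

  substituteCircuit-computes : ∀ P H (Cf : Circuit (Var n e)) → Computes Cf (smPoly n e P) →
                               (Ch : Fin n → Fin e → Circuit (Var m d)) →
                               (∀ i b → Computes (Ch i b) (smPoly m d (H i b))) →
                               Computes (substituteCircuit Cf Ch) (substitute n e m d P H)
  substituteCircuit-computes P H Cf Cf-computes Ch Ch-computes a = begin
    eval (substituteCircuit Cf Ch) a  ≡⟨ eval-compose _ Cf a ⟩
    eval Cf (value T a)               ≡⟨ Cf-computes (value T a) ⟩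
    smPoly n e P (value T a)          ≡⟨ smPoly-cong n e P (λ (i , b) → value-T i b) ⟩
    substitute n e m d P H a          ∎
    where
    open ≡-Reasoning
    T : Tabulation (Fin n × Var m d) (Var n e)
    T = ⨁ n (λ i → circuits e (rename (i ,_) ∘ Ch i))
    value-T : ∀ i b → value T a (i , b) ≡ smPoly m d (H i b) (λ u → a (i , u))
    value-T i b = begin
      value T a (i , b)                          ≡⟨ value-⨁ n _ a i b ⟩
      value (circuits e _) a b                   ≡⟨ value-circuits e _ a b ⟩
      eval (rename (i ,_) (Ch i b)) a            ≡⟨ eval-rename (i ,_) (Ch i b) a ⟩
      eval (Ch i b) (λ u → a (i , u))            ≡⟨ Ch-computes i b _ ⟩
      smPoly m d (H i b) (λ u → a (i , u))       ∎

  circuitSize-substituteCircuit : ∀ (Cf : Circuit (Var n e)) (Ch : Fin n → Fin e → Circuit (Var m d)) →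
    circuitSize (substituteCircuit Cf Ch)
      ≤ sumFinℕ n (λ i → sumFinℕ e (circuitSize ∘ Ch i)) + 2 * circuitSize Cf
  circuitSize-substituteCircuit Cf Ch =
    ≤-trans (circuitSize-compose _ Cf)
            (+-monoˡ-≤ _ (≤-reflexive (trans (size-⨁ n _) (sumFinℕ-cong n block))))
    where
    block : ∀ i → size (circuits e (rename (i ,_) ∘ Ch i)) ≡ sumFinℕ e (circuitSize ∘ Ch i)
    block i = trans (size-circuits e _) (sumFinℕ-cong e (λ b → circuitSize-rename (i ,_) (Ch i b)))

uniformBlock-≤ : ∀ m d {c} → 0 < c → (m * (suc d + suc (suc d)) + suc m) + c ≤ 4 * (m * suc d + c)
uniformBlock-≤ m d {suc c} _ = begin
  (m * (suc d + suc (suc d)) + suc m) + suc c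
    ≤⟨ m≤m+n _ (2 * (m * d) + 2 + 3 * c) ⟩
  (m * (suc d + suc (suc d)) + suc m) + suc c + (2 * (m * d) + 2 + 3 * c)
    ≡⟨ identity m d c ⟩
  4 * (m * suc d + suc c)  ∎
  where
  open ≤-Reasoning
  identity : ∀ m d c → (m * (suc d + suc (suc d)) + suc m) + suc c + (2 * (m * d) + 2 + 3 * c)
                       ≡ 4 * (m * suc d + suc c)
  identity = solve-∀

total-≤ : ∀ N c S → S + (4 * S + 2 * c) ≤ 5 * ((N + c) + S)
total-≤ N c S = begin
  S + (4 * S + 2 * c)                     ≤⟨ m≤m+n _ (5 * N + 3 * c) ⟩
  S + (4 * S + 2 * c) + (5 * N + 3 * c)   ≡⟨ identity N c S ⟩
  5 * ((N + c) + S)                       ∎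
  where
  open ≤-Reasoning
  identity : ∀ N c S → S + (4 * S + 2 * c) + (5 * N + 3 * c) ≡ 5 * ((N + c) + S)
  identity = solve-∀

hcomp-circuit : ∀ n m d .{{_ : NonZero d}} (P : Outcome n 2 → ℚ) (G : Fin n → Outcome m d → ℚ)
  → (Cf : Circuit (Var n 2)) → Computes Cf (smPoly n 2 P)
  → (Cg : Fin n → Circuit (Var m d)) → (∀ i → Computes (Cg i) (smPoly m d (G i)))
  → ∃[ C ] (Computes C (hcomp n m d P G)
            × pcSize (n * (m * d)) C
              ≤ 5 * (pcSize (n * 2) Cf + sumFinℕ n (λ i → pcSize (m * d) (Cg i))))
hcomp-circuit n m zero {{()}}
hcomp-circuit n m (suc d) P G Cf Cf-computes Cg Cg-computes =
  substituteCircuit Cf Ch , computes , size-≤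
  where
  Ch : Fin n → Fin 2 → Circuit (Var m (suc d))
  Ch i = cons (uniformCircuit m (suc d)) (λ _ → Cg i)

  H : Fin n → Fin 2 → Outcome m (suc d) → ℚ
  H = hcompSubstituent m (suc d) ∘ G

  Ch-computes : ∀ i b → Computes (Ch i b) (smPoly m (suc d) (H i b))
  Ch-computes i zero       a = trans (eval-uniformCircuit m (suc d) a) (uniformPoly-smPoly m (suc d) a)
  Ch-computes i (suc zero)   = Cg-computes i

  computes : Computes (substituteCircuit Cf Ch) (hcomp n m (suc d) P G)
  computes a = trans (substituteCircuit-computes P H Cf Cf-computes Ch Ch-computes a)
                     (sym (hcomp-substitute n m (suc d) P G a))

  S : ℕ
  S = sumFinℕ n (λ i → pcSize (m * suc d) (Cg i))

  block-≤ : ∀ i → sumFinℕ 2 (circuitSize ∘ Ch i) ≤ 4 * pcSize (m * suc d) (Cg i)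
  block-≤ i = begin
    circuitSize (uniformCircuit m (suc d)) + (circuitSize (Cg i) + 0)
      ≡⟨ cong₂ _+_ (circuitSize-uniformCircuit m (suc d)) (+-identityʳ _) ⟩
    (m * (suc d + suc (suc d)) + suc m) + circuitSize (Cg i)
      ≤⟨ uniformBlock-≤ m d (circuitSize-positive (Cg i)) ⟩
    4 * (m * suc d + circuitSize (Cg i))  ∎
    where open ≤-Reasoning

  blocks-≤ : sumFinℕ n (λ i → sumFinℕ 2 (circuitSize ∘ Ch i)) ≤ 4 * S
  blocks-≤ = ≤-trans (sumFinℕ-mono-≤ n block-≤) (≤-reflexive (sumFinℕ-*ˡ n 4 _))

  leaves-≤ : n * (m * suc d) ≤ S
  leaves-≤ = ≤-trans (≤-reflexive (sym (sumFinℕ-const n (m * suc d))))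
                     (sumFinℕ-mono-≤ n (λ i → m≤m+n (m * suc d) (circuitSize (Cg i))))

  size-≤ : pcSize (n * (m * suc d)) (substituteCircuit Cf Ch) ≤ 5 * (pcSize (n * 2) Cf + S)
  size-≤ = begin
    n * (m * suc d) + circuitSize (substituteCircuit Cf Ch)
      ≤⟨ +-mono-≤ leaves-≤ (circuitSize-substituteCircuit Cf Ch) ⟩
    S + (sumFinℕ n (λ i → sumFinℕ 2 (circuitSize ∘ Ch i)) + 2 * circuitSize Cf)
      ≤⟨ +-monoʳ-≤ S (+-monoˡ-≤ _ blocks-≤) ⟩
    S + (4 * S + 2 * circuitSize Cf)
      ≤⟨ total-≤ (n * 2) (circuitSize Cf) S ⟩
    5 * (pcSize (n * 2) Cf + S)  ∎
    where open ≤-Reasoning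

proposition5 :
    ∃[ c ] ∀ (n m d : ℕ) .{{_ : NonZero d}}
      (P : Outcome n 2 → ℚ) (G : Fin n → Outcome m d → ℚ)
      → IsDist n 2 P → (∀ i → IsDist m d (G i))
      → (Cf : Circuit (Var n 2)) → Computes Cf (smPoly n 2 P)
      → (Cg : Fin n → Circuit (Var m d)) → (∀ i → Computes (Cg i) (smPoly m d (G i)))
      → IsDistPoly n m d (hcomp n m d P G)
        × (∃[ C ] (Computes C (hcomp n m d P G)
                   × pcSize (n * (m * d)) C
                     ≤ c * (pcSize (n * 2) Cf + sumFinℕ n (λ i → pcSize (m * d) (Cg i)))))
proposition5 = 5 , λ n m d P G isDistP isDistG Cf Cf-computes Cg Cg-computes →
  hcomp-isDistPoly n m d P G isDistP isDistG , hcomp-circuit n m d P G Cf Cf-computes Cg Cg-computes
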